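{- Let $k\ge 1$ and $n\ge 0$ be integers. The number of elements of $C_k\wr S_n$ that bi-avoid the pattern $(1\text{ - }2,\,0~0)$ equals $$\sum_{\substack{i_1+\cdots+i_k=n\\ i_1,\ldots,i_k\ge 0}}\binom{n}{i_1,\ldots,i_k}^2 .$$
   Context: For integers $k\ge1$, $n\ge0$, $C_k\wr S_n$ denotes the set of pairs $(\sigma,w)$ where $\sigma=\sigma_1\cdots\sigma_n$ is a permutation of $\{1,\dots,n\}$ in one-line notation and $w=w_1\cdots w_n\in\{0,1,\dots,k-1\}^n$ (the color of $\sigma_i$ is $w_i$). For a sequence of distinct integers $a_1\cdots a_j$, $\mathrm{red}(a_1\cdots a_j)$ is the permutation of $\{1,\dots,j\}$ obtained by replacing the $i$-th smallest entry by $i$; for a word $u$ over nonnegative integers, $\mathrm{red}(u)$ is obtained by replacing every occurrence of the $i$-th smallest distinct letter by $i-1$. A pattern $(\tau,u)$ consists of $\tau\in S_j$ and a word $u$ of length $j$ with $\mathrm{red}(u)=u$; the notation $(1\text{ - }2,\,0~0)$ means $\tau=12$, $u=00$ (dashes indicate that the positions need not be adjacent). $(\tau,u)$ bi-occurs in $(\sigma,w)\in C_k\wr S_n$ if there are indices $1\le i_1<\cdots<i_j\le n$ with $\mathrm{red}(\sigma_{i_1}\cdots\sigma_{i_j})=\tau$ and $\mathrm{red}(w_{i_1}\cdots w_{i_j})=u$; $(\sigma,w)$ bi-avoids $(\tau,u)$ if there is no bi-occurrence. Thus $(\sigma,w)$ bi-avoids $(1\text{ - }2,0~0)$ iff there are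 no $i<j$ with $\sigma_i<\sigma_j$ and $w_i=w_j$. -}

module Defs where

open import Data.Nat using (NonZero; ℕ; zero; suc; _+_; _*_; _/_; _≟_; _!)
open import Data.Nat.Properties using (m*n≢0; _!≢0)
open import Data.Nat.ListAction using (sum)
open import Data.Fin using (Fin)
open import Data.Vec using (Vec; []; _∷_; lookup)
open import Data.List using (List; []; _∷_; concatMap; map; length; filter; upTo; allFin)
open import Data.List.Membership.Propositional using (_∈_)
open import Data.List.Relation.Unary.Unique.Propositional using (Unique)
open import Data.Fin.Base using () renaming (_<_ to _<ᶠ_)
open import Data.Product using (_×_; _,_; Σ)
open import Relation.Nullary using (¬_)
open import Relation.Binary.PropositionalEquality using (_≡_)

allVecsOver : {A : Set} → List A → (n : ℕ) → List (Vec A n)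
allVecsOver xs zero    = [] ∷ []
allVecsOver xs (suc n) = concatMap (λ x → map (x ∷_) (allVecsOver xs n)) xs

allFinL : (m : ℕ) → List (Fin m)
allFinL m = allFin m

-- An element of C_k ≀ S_n: a pair (σ , w) where σ is given in one-line
-- notation as a vector σ_1 … σ_n with values in Fin n (value j stands for j+1)
-- which is a permutation (i.e. injective), and w is a color vector in {0..k-1}^n.
IsPerm : {n : ℕ} → Vec (Fin n) n → Set
IsPerm {n} σ = ∀ (i j : Fin n) → lookup σ i ≡ lookup σ j → i ≡ j

BiAvoids12-00 : {k n : ℕ} → Vec (Fin n) n → Vec (Fin k) n → Set
BiAvoids12-00 {k} {n} σ w =
  ∀ (i j : Fin n) → i <ᶠ j → lookup σ i <ᶠ lookup σ j → ¬ (lookup w i ≡ lookup w j)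

Good : (k n : ℕ) → Vec (Fin n) n × Vec (Fin k) n → Set
Good k n (σ , w) = IsPerm σ × BiAvoids12-00 σ w

HasCard : {A : Set} → (A → Set) → ℕ → Set
HasCard {A} P m = Σ (List A) λ L → Unique L × (∀ x → (x ∈ L → P x) × (P x → x ∈ L)) × (length L ≡ m)

prodFact : {k : ℕ} → Vec ℕ k → ℕ
prodFact []       = 1
prodFact (i ∷ is) = (i !) * prodFact is

prodFact-nonZero : {k : ℕ} → (is : Vec ℕ k) → NonZero (prodFact is)
prodFact-nonZero []       = _
prodFact-nonZero (i ∷ is) = m*n≢0 (i !) (prodFact is) {{i !≢0}} {{prodFact-nonZero is}}

multinomial : (n : ℕ) {k : ℕ} → Vec ℕ k → ℕ
multinomial n is = (n !) / prodFact is
  where instance _ = prodFact-nonZero is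

sumVec : {k : ℕ} → Vec ℕ k → ℕ
sumVec []       = 0
sumVec (i ∷ is) = i + sumVec is

compositions : (n k : ℕ) → List (Vec ℕ k)
compositions n k = filter (λ v → sumVec v ≟ n) (allVecsOver (upTo (suc n)) k)

multinomialSqSum : (n k : ℕ) → ℕ
multinomialSqSum n k = sum (map (λ v → multinomial n v * multinomial n v) (compositions n k))

-- A coloured permutation (σ , w) bi-avoids (1-2, 0 0) exactly when the values of each colour class
-- decrease from left to right. Record, for every value v, the colour u_v of the position holding v:
-- then u has the same content as w, and (σ , w) is recovered from (w , u) by giving position 1 the
-- largest value of colour w₁, position 2 the largest remaining value of colour w₂, and so on.
-- Conversely this greedy filling turns every pair of words (w , u) with equal content into a
-- bi-avoiding coloured permutation. So the count is the number of such pairs, Σₐ |W(a)|², where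
-- W(a) is the set of words of content a, and |W(a)| · a₁! ⋯ aₖ! = n! by removing the first letter.

module Submission where

open import Data.Bool using (true; false; if_then_else_)
open import Data.Fin as Fin using (Fin; zero; suc; punchIn; punchOut; _≟_)
import Data.Fin.Properties as Fin
open import Data.List as List using (List; []; _∷_; _++_; filter; concatMap; length; allFin; cartesianProduct; upTo)
import Data.List.Properties as List
open import Data.List.Membership.Propositional using (_∈_)
open import Data.List.Membership.Propositional.Properties
open import Data.List.Relation.Unary.All as All using (All; []; _∷_)
open import Data.List.Relation.Unary.Any as Any using (here)
import Data.List.Relation.Unary.All.Properties as Allₚ
import Data.List.Relation.Unary.AllPairs as AllPairs
import Data.List.Relation.Unary.AllPairs.Properties as AllPairsₚ
open import Data.List.Relation.Unary.Unique.Propositional using (Unique; []; _∷_)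
import Data.List.Relation.Unary.Unique.Propositional.Properties as Unique
open import Data.Nat as ℕ using (ℕ; zero; suc; _+_; _*_; _≤_; z≤n; s≤s; _!; _/_)
import Data.Nat.Properties as ℕ
import Algebra.Properties.CommutativeSemigroup ℕ.*-commutativeSemigroup as ℕ*
open import Data.Nat.DivMod using (m*n/n≡m)
open import Data.Nat.ListAction using (sum)
open import Data.Product using (_×_; _,_; ∃; proj₁; proj₂; uncurry)
open import Data.Sum using (_⊎_; inj₁; inj₂; [_,_]′)
open import Data.Vec as Vec using (Vec; []; _∷_; lookup; tabulate; map; insertAt; removeAt; updateAt; count)
import Data.Vec.Properties as Vec
open import Data.Vec.Relation.Binary.Pointwise.Extensional using (ext; Pointwise-≡⇒≡)
open import Function using (_∘_; id)
open import Relation.Binary using (tri<; tri≈; tri>)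
open import Relation.Binary.PropositionalEquality
open import Relation.Nullary using (Dec; yes; no; does; contradiction)
import Relation.Unary
open import Relation.Nullary.Decidable using (dec-true)

open import Defs

private variable
  A B : Set
  k n : ℕ

lookup-ext : {xs ys : Vec A n} → (∀ i → lookup xs i ≡ lookup ys i) → xs ≡ ys
lookup-ext = Pointwise-≡⇒≡ ∘ ext

lookup-removeAt : (xs : Vec A (suc n)) (i : Fin (suc n)) (j : Fin n) →
                  lookup (removeAt xs i) j ≡ lookup xs (punchIn i j)
lookup-removeAt xs i j = begin
  lookup (removeAt xs i) j
    ≡⟨ Vec.insertAt-punchIn (removeAt xs i) i (lookup xs i) j ⟨
  lookup (insertAt (removeAt xs i) i (lookup xs i)) (punchIn i j)
    ≡⟨ cong (λ ys → lookup ys (punchIn i j)) (Vec.insertAt-removeAt xs i) ⟩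
  lookup xs (punchIn i j) ∎
  where open ≡-Reasoning

insertAt-removeAt′ : ∀ (xs : Vec A (suc n)) i {x} → lookup xs i ≡ x → insertAt (removeAt xs i) i x ≡ xs
insertAt-removeAt′ xs i refl = Vec.insertAt-removeAt xs i

punchIn-mono-< : ∀ (v : Fin (suc n)) {i j} → i Fin.< j → punchIn v i Fin.< punchIn v j
punchIn-mono-< v {i} {j} i<j = Fin.≤∧≢⇒< (Fin.punchIn-mono-≤ v i j (ℕ.<⇒≤ i<j))
                                          (λ eq → Fin.<-irrefl (Fin.punchIn-injective v i j eq) i<j)

punchIn-cancel-< : ∀ (v : Fin (suc n)) {i j} → punchIn v i Fin.< punchIn v j → i Fin.< j
punchIn-cancel-< v {i} {j} lt = Fin.≤∧≢⇒< (Fin.punchIn-cancel-≤ v i j (ℕ.<⇒≤ lt))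
                                           (λ eq → Fin.<-irrefl (cong (punchIn v) eq) lt)

module _ {P : B → Set} (P? : Relation.Unary.Decidable P) where

  filter-concatMap : ∀ (f : A → List B) xs → filter P? (concatMap f xs) ≡ concatMap (filter P? ∘ f) xs
  filter-concatMap f []       = refl
  filter-concatMap f (x ∷ xs) = trans (List.filter-++ P? (f x) (concatMap f xs))
                                      (cong (filter P? (f x) ++_) (filter-concatMap f xs))

  filter-map : ∀ (f : A → B) xs → filter P? (List.map f xs) ≡ List.map f (filter (P? ∘ f) xs)
  filter-map f []       = refl
  filter-map f (x ∷ xs) with does (P? (f x))
  ... | true  = cong (f x ∷_) (filter-map f xs)
  ... | false = filter-map f xs

length-concatMap : ∀ (f : A → List B) xs → length (concatMap f xs) ≡ sum (List.map (length ∘ f) xs)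
length-concatMap f []       = refl
length-concatMap f (x ∷ xs) =
  trans (List.length-++ (f x)) (cong (length (f x) +_) (length-concatMap f xs))

length-cartesianProduct : ∀ (xs : List A) (ys : List B) →
                          length (cartesianProduct xs ys) ≡ length xs * length ys
length-cartesianProduct []       ys = refl
length-cartesianProduct (x ∷ xs) ys = trans (List.length-++ (List.map (x ,_) ys))
  (cong₂ _+_ (List.length-map (x ,_) ys) (length-cartesianProduct xs ys))

sum-map-*ʳ : ∀ (f : A → ℕ) m xs → sum (List.map f xs) * m ≡ sum (List.map (λ x → f x * m) xs)
sum-map-*ʳ f m []       = refl
sum-map-*ʳ f m (x ∷ xs) = trans (ℕ.*-distribʳ-+ m (f x) _) (cong (f x * m +_) (sum-map-*ʳ f m xs))

Unique-concatMap : ∀ (f : A → List B) {xs} → Unique xs → (∀ x → Unique (f x)) →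
                   (∀ {x y z} → z ∈ f x → z ∈ f y → x ≡ y) → Unique (concatMap f xs)
Unique-concatMap f {xs} xs! f! images-disjoint = Unique.concat⁺
  (Allₚ.map⁺ (All.universal f! xs))
  (AllPairsₚ.map⁺ (AllPairs.map (λ x≢y {_} (z∈fx , z∈fy) → x≢y (images-disjoint z∈fx z∈fy)) xs!))

allVecsOver-unique : ∀ {xs : List A} n → Unique xs → Unique (allVecsOver xs n)
allVecsOver-unique zero    _   = [] ∷ []
allVecsOver-unique {A = A} {xs = xs} (suc n) xs! = Unique-concatMap _ xs!
  (λ x → Unique.map⁺ Vec.∷-injectiveʳ (allVecsOver-unique n xs!)) heads≡
  where
  heads≡ : ∀ {x y} {v : Vec A (suc n)} →
           v ∈ List.map (x ∷_) (allVecsOver xs n) → v ∈ List.map (y ∷_) (allVecsOver xs n) → x ≡ y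
  heads≡ v∈x v∈y with ∈-map⁻ _ v∈x | ∈-map⁻ _ v∈y
  ... | _ , _ , refl | _ , _ , eq = Vec.∷-injectiveˡ eq

allVecsOver-complete : ∀ {xs : List A} n (v : Vec A n) → (∀ i → lookup v i ∈ xs) → v ∈ allVecsOver xs n
allVecsOver-complete           zero    []      _    = here refl
allVecsOver-complete {xs = xs} (suc n) (y ∷ v) v⊆xs =
  ∈-concatMap⁺ (λ x → List.map (x ∷_) (allVecsOver xs n))
    (Any.map (λ { refl → ∈-map⁺ (y ∷_) (allVecsOver-complete n v (v⊆xs ∘ suc)) }) (v⊆xs zero))

HasCard-bijection : ∀ {P : A → Set} {Q : B → Set} {m} (f : A → B) →
                    (∀ a → P a → Q (f a)) →
                    (∀ a a' → P a → P a' → f a ≡ f a' → a ≡ a') →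
                    (∀ b → Q b → ∃ λ a → P a × f a ≡ b) →
                    HasCard P m → HasCard Q m
HasCard-bijection {P = P} {Q} f f-maps f-injective f-onto (xs , xs! , xs-spec , |xs|≡m) =
  List.map f xs , map-unique (All.tabulate (proj₁ (xs-spec _))) xs! , spec ,
  trans (List.length-map f xs) |xs|≡m
  where
  map-unique : ∀ {ys} → All P ys → Unique ys → Unique (List.map f ys)
  map-unique []       []           = []
  map-unique (p ∷ ps) (y∉ys ∷ ys!) =
    Allₚ.map⁺ (All.zipWith (λ (q , y≢z) → y≢z ∘ f-injective _ _ p q) (ps , y∉ys)) ∷ map-unique ps ys!

  spec : ∀ b → (b ∈ List.map f xs → Q b) × (Q b → b ∈ List.map f xs)
  spec b = (λ b∈ → case-∈ (∈-map⁻ f b∈)) , λ q → case-onto (f-onto b q)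
    where
    case-∈ : ∃ (λ a → a ∈ xs × b ≡ f a) → Q b
    case-∈ (a , a∈ , refl) = f-maps a (proj₁ (xs-spec a) a∈)
    case-onto : ∃ (λ a → P a × f a ≡ b) → b ∈ List.map f xs
    case-onto (a , p , refl) = ∈-map⁺ f (proj₂ (xs-spec a) p)

-- Occurrences of a colour

occ : Fin k → Vec (Fin k) n → ℕ
occ c = count (c ≟_)

SameContent : Vec (Fin k) n → Vec (Fin k) n → Set
SameContent w u = ∀ c → occ c w ≡ occ c u

occ-∷-cong : ∀ (c x : Fin k) (w u : Vec (Fin k) n) →
             occ c w ≡ occ c u → occ c (x ∷ w) ≡ occ c (x ∷ u)
occ-∷-cong c x w u = cong (if does (c ≟ x) then suc else id)

occ-∷-cancel : ∀ (c x : Fin k) (w u : Vec (Fin k) n) →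
               occ c (x ∷ w) ≡ occ c (x ∷ u) → occ c w ≡ occ c u
occ-∷-cancel c x w u eq with does (c ≟ x)
... | true  = ℕ.suc-injective eq
... | false = eq

occ-swap : ∀ (c x y : Fin k) (w : Vec (Fin k) n) → occ c (x ∷ y ∷ w) ≡ occ c (y ∷ x ∷ w)
occ-swap c x y w with does (c ≟ x) | does (c ≟ y)
... | true  | true  = refl
... | true  | false = refl
... | false | true  = refl
... | false | false = refl

occ-insertAt : ∀ (c : Fin k) (u : Vec (Fin k) n) i x → occ c (insertAt u i x) ≡ occ c (x ∷ u)
occ-insertAt c u       zero    x = refl
occ-insertAt c (y ∷ u) (suc i) x =
  trans (occ-∷-cong c y (insertAt u i x) (x ∷ u) (occ-insertAt c u i x)) (occ-swap c y x u)

occ-∷-self : ∀ (c : Fin k) (w : Vec (Fin k) n) → occ c (c ∷ w) ≡ suc (occ c w)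
occ-∷-self c w rewrite dec-true (c ≟ c) refl = refl

occ-absent : ∀ (c : Fin k) (u : Vec (Fin k) n) → (∀ i → lookup u i ≢ c) → occ c u ≡ 0
occ-absent c []      absent = refl
occ-absent c (x ∷ u) absent with c ≟ x
... | yes refl = contradiction refl (absent zero)
... | no  _    = occ-absent c u (absent ∘ suc)

SameContent-∷ : ∀ (x : Fin k) (w u : Vec (Fin k) n) → SameContent w u → SameContent (x ∷ w) (x ∷ u)
SameContent-∷ x w u same c = occ-∷-cong c x w u (same c)

SameContent-∷⁻ : ∀ (x : Fin k) (w u : Vec (Fin k) n) → SameContent (x ∷ w) (x ∷ u) → SameContent w u
SameContent-∷⁻ x w u same c = occ-∷-cancel c x w u (same c)

SameContent-insertAt : ∀ (c : Fin k) (w u : Vec (Fin k) n) i →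
                       SameContent w u → SameContent (c ∷ w) (insertAt u i c)
SameContent-insertAt c w u i same d = trans (SameContent-∷ c w u same d) (sym (occ-insertAt d u i c))

SameContent-removeAt : ∀ (c : Fin k) (w : Vec (Fin k) n) u i → lookup u i ≡ c →
                       SameContent (c ∷ w) u → SameContent w (removeAt u i)
SameContent-removeAt c w u i refl same = SameContent-∷⁻ c w (removeAt u i) λ d → begin
  occ d (c ∷ w)                              ≡⟨ same d ⟩
  occ d u                                    ≡⟨ cong (occ d) (Vec.insertAt-removeAt u i) ⟨
  occ d (insertAt (removeAt u i) i c)        ≡⟨ occ-insertAt d (removeAt u i) i c ⟩
  occ d (c ∷ removeAt u i)                   ∎
  where open ≡-Reasoning

IsLastOccurrence : Fin k → Vec (Fin k) n → Fin n → Set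
IsLastOccurrence c u i = lookup u i ≡ c × (∀ j → i Fin.< j → lookup u j ≢ c)

lastOccurrence : (c : Fin k) (u : Vec (Fin k) n) → ∃ (IsLastOccurrence c u) ⊎ (∀ i → lookup u i ≢ c)
lastOccurrence c []      = inj₂ λ ()
lastOccurrence c (x ∷ u) with lastOccurrence c u
... | inj₁ (i , ui≡c , later≢c) =
  inj₁ (suc i , ui≡c , λ { zero () ; (suc j) (s≤s i<j) → later≢c j i<j })
... | inj₂ absent with x ≟ c
...   | yes x≡c = inj₁ (zero , x≡c , λ { zero () ; (suc j) _ → absent j })
...   | no  x≢c = inj₂ λ { zero → x≢c ; (suc j) → absent j }

IsLastOccurrence-unique : ∀ (c : Fin k) (u : Vec (Fin k) n) {i j} →
                          IsLastOccurrence c u i → IsLastOccurrence c u j → i ≡ j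
IsLastOccurrence-unique c u {i} {j} (ui≡c , after-i) (uj≡c , after-j) with Fin.<-cmp i j
... | tri< i<j _ _ = contradiction uj≡c (after-i j i<j)
... | tri≈ _ i≡j _ = i≡j
... | tri> _ _ j<i = contradiction ui≡c (after-j i j<i)

-- When c does not occur in u the junk value zero is returned.
lastIndexOf : Fin k → Vec (Fin k) (suc n) → Fin (suc n)
lastIndexOf c u = [ proj₁ , (λ _ → zero) ]′ (lastOccurrence c u)

lastIndexOf-isLast : ∀ (c : Fin k) (u : Vec (Fin k) (suc n)) →
                     occ c u ≢ 0 → IsLastOccurrence c u (lastIndexOf c u)
lastIndexOf-isLast c u occ≢0 with lastOccurrence c u
... | inj₁ (_ , last) = last
... | inj₂ absent     = contradiction (occ-absent c u absent) occ≢0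

-- Permutations in one-line notation

prepend : Fin (suc n) → Vec (Fin n) n → Vec (Fin (suc n)) (suc n)
prepend v τ = v ∷ map (punchIn v) τ

lookup-prepend : ∀ (v : Fin (suc n)) τ j → lookup (prepend v τ) (suc j) ≡ punchIn v (lookup τ j)
lookup-prepend v τ j = Vec.lookup-map j (punchIn v) τ

prepend-isPerm : ∀ (v : Fin (suc n)) {τ} → IsPerm τ → IsPerm (prepend v τ)
prepend-isPerm v {τ} perm zero    zero    _  = refl
prepend-isPerm v {τ} perm zero    (suc j) eq =
  contradiction (sym (trans eq (lookup-prepend v τ j))) (Fin.punchInᵢ≢i v _)
prepend-isPerm v {τ} perm (suc i) zero    eq =
  contradiction (trans (sym (lookup-prepend v τ i)) eq) (Fin.punchInᵢ≢i v _)
prepend-isPerm v {τ} perm (suc i) (suc j) eq = cong suc (perm i j (Fin.punchIn-injective v _ _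
  (trans (sym (lookup-prepend v τ i)) (trans eq (lookup-prepend v τ j)))))

prepend-injective : ∀ {v v' : Fin (suc n)} {τ τ'} → prepend v τ ≡ prepend v' τ' → v ≡ v' × τ ≡ τ'
prepend-injective {v = v} {τ = τ} {τ'} eq with Vec.∷-injectiveˡ eq
... | refl = refl , lookup-ext λ j → Fin.punchIn-injective v _ _
  (trans (sym (lookup-prepend v τ j)) (trans (cong (λ σ → lookup σ (suc j)) eq) (lookup-prepend v τ' j)))

isPerm-prepend⁻ : ∀ (v : Fin (suc n)) τ → IsPerm (v ∷ τ) →
                  ∃ λ τ' → IsPerm τ' × prepend v τ' ≡ v ∷ τ
isPerm-prepend⁻ v τ perm = τ' , τ'-isPerm , cong (v ∷_) (lookup-ext λ j → begin
    lookup (map (punchIn v) τ') j    ≡⟨ lookup-prepend v τ' j ⟩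
    punchIn v (lookup τ' j)          ≡⟨ cong (punchIn v) (Vec.lookup∘tabulate _ j) ⟩
    punchIn v (punchOut (v≢τ j))     ≡⟨ Fin.punchIn-punchOut (v≢τ j) ⟩
    lookup τ j                       ∎)
  where
  open ≡-Reasoning
  v≢τ : ∀ j → v ≢ lookup τ j
  v≢τ j eq with perm zero (suc j) eq
  ... | ()
  τ' = tabulate (λ j → punchOut (v≢τ j))
  τ'-isPerm : IsPerm τ'
  τ'-isPerm i j eq = Fin.suc-injective (perm (suc i) (suc j) (Fin.punchOut-injective (v≢τ i) (v≢τ j)
    (trans (sym (Vec.lookup∘tabulate _ i)) (trans eq (Vec.lookup∘tabulate _ j)))))

-- A missed value y would make σ an injection of Fin (1 + n) into Fin n.
isPerm⇒surjective : (σ : Vec (Fin n) n) → IsPerm σ → ∀ y → ∃ λ i → lookup σ i ≡ y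
isPerm⇒surjective {zero}  σ perm ()
isPerm⇒surjective {suc n} σ perm y with Fin.any? (λ i → lookup σ i ≟ y)
... | yes hit = hit
... | no miss = contradiction (Fin.injective⇒≤ {f = squeeze} squeeze-injective) ℕ.1+n≰n
  where
  y≢σ : ∀ i → y ≢ lookup σ i
  y≢σ i eq = miss (i , sym eq)
  squeeze : Fin (suc n) → Fin n
  squeeze i = punchOut (y≢σ i)
  squeeze-injective : ∀ {i j} → squeeze i ≡ squeeze j → i ≡ j
  squeeze-injective {i} {j} eq = perm i j (Fin.punchOut-injective (y≢σ i) (y≢σ j) eq)

BiAvoids-prepend⁻ : ∀ (v : Fin (suc n)) τ (c : Fin k) w →
                    BiAvoids12-00 (prepend v τ) (c ∷ w) → BiAvoids12-00 τ w
BiAvoids-prepend⁻ v τ c w avoids i j i<j τi<τj = avoids (suc i) (suc j) (s≤s i<j)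
  (subst₂ Fin._<_ (sym (lookup-prepend v τ i)) (sym (lookup-prepend v τ j)) (punchIn-mono-< v τi<τj))

BiAvoids-prepend⁺ : ∀ (v : Fin (suc n)) τ (c : Fin k) w → BiAvoids12-00 τ w →
                    (∀ j → v Fin.< lookup (prepend v τ) (suc j) → lookup w j ≢ c) →
                    BiAvoids12-00 (prepend v τ) (c ∷ w)
BiAvoids-prepend⁺ v τ c w avoids head-ok zero    (suc j) _         v<τj  = head-ok j v<τj ∘ sym
BiAvoids-prepend⁺ v τ c w avoids head-ok (suc i) (suc j) (s≤s i<j) τi<τj = avoids i j i<j
  (punchIn-cancel-< v (subst₂ Fin._<_ (lookup-prepend v τ i) (lookup-prepend v τ j) τi<τj))

-- Decreasing arrangement of the values inside each colour class

ValueColouring : Vec (Fin n) n → Vec (Fin k) n → Vec (Fin k) n → Set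
ValueColouring σ w u = ∀ i → lookup u (lookup σ i) ≡ lookup w i

-- Position 1 receives the largest value of colour w₁, i.e. the last occurrence of w₁ in u.
arrange : Vec (Fin k) n → Vec (Fin k) n → Vec (Fin n) n
arrange []      []  = []
arrange (c ∷ w) u   = prepend (lastIndexOf c u) (arrange w (removeAt u (lastIndexOf c u)))

SameContent⇒isLastOccurrence : ∀ (c : Fin k) (w : Vec (Fin k) n) u → SameContent (c ∷ w) u →
                               IsLastOccurrence c u (lastIndexOf c u)
SameContent⇒isLastOccurrence c w u same = lastIndexOf-isLast c u λ occ≡0 →
  ℕ.1+n≢0 (trans (sym (occ-∷-self c w)) (trans (same c) occ≡0))

SameContent-removeLast : ∀ (c : Fin k) (w : Vec (Fin k) n) u → SameContent (c ∷ w) u →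
                         SameContent w (removeAt u (lastIndexOf c u))
SameContent-removeLast c w u same =
  SameContent-removeAt c w u (lastIndexOf c u) (proj₁ (SameContent⇒isLastOccurrence c w u same)) same

arrange-isPerm : ∀ (w u : Vec (Fin k) n) → IsPerm (arrange w u)
arrange-isPerm []      []  = λ ()
arrange-isPerm (c ∷ w) u   = prepend-isPerm _ (arrange-isPerm w _)

arrange-colours : ∀ (w u : Vec (Fin k) n) → SameContent w u → ValueColouring (arrange w u) w u
arrange-colours []      []  _    ()
arrange-colours (c ∷ w) u same zero    = proj₁ (SameContent⇒isLastOccurrence c w u same)
arrange-colours (c ∷ w) u same (suc j) = begin
  lookup u (lookup (prepend v σ) (suc j))   ≡⟨ cong (lookup u) (lookup-prepend v σ j) ⟩
  lookup u (punchIn v (lookup σ j))         ≡⟨ lookup-removeAt u v (lookup σ j) ⟨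
  lookup (removeAt u v) (lookup σ j)        ≡⟨ arrange-colours w (removeAt u v) same′ j ⟩
  lookup w j                                ∎
  where
  open ≡-Reasoning
  v = lastIndexOf c u
  σ = arrange w (removeAt u v)
  same′ = SameContent-removeLast c w u same

arrange-biAvoids : ∀ (w u : Vec (Fin k) n) → SameContent w u → BiAvoids12-00 (arrange w u) w
arrange-biAvoids []      []  _    ()
arrange-biAvoids (c ∷ w) u same =
  BiAvoids-prepend⁺ v σ c w (arrange-biAvoids w (removeAt u v) (SameContent-removeLast c w u same)) later≢c
  where
  v = lastIndexOf c u
  σ = arrange w (removeAt u v)
  later≢c : ∀ j → v Fin.< lookup (prepend v σ) (suc j) → lookup w j ≢ c
  later≢c j v<σj wj≡c = proj₂ (SameContent⇒isLastOccurrence c w u same) _ v<σj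
    (trans (arrange-colours (c ∷ w) u same (suc j)) wj≡c)

arrange-injective : ∀ (w u u' : Vec (Fin k) n) → SameContent w u → SameContent w u' →
                    arrange w u ≡ arrange w u' → u ≡ u'
arrange-injective []      []  []  _    _     _  = refl
arrange-injective (c ∷ w) u   u'  same same' eq with prepend-injective eq
... | v≡v' , σ≡σ' = begin
  u                                ≡⟨ insertAt-removeAt′ u v uv≡c ⟨
  insertAt (removeAt u v) v c      ≡⟨ cong₂ (λ r i → insertAt r i c) rest≡rest' v≡v' ⟩
  insertAt (removeAt u' v') v' c   ≡⟨ insertAt-removeAt′ u' v' u'v'≡c ⟩
  u'                               ∎
  where
  open ≡-Reasoning
  v = lastIndexOf c u
  v' = lastIndexOf c u'
  uv≡c = proj₁ (SameContent⇒isLastOccurrence c w u same)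
  u'v'≡c = proj₁ (SameContent⇒isLastOccurrence c w u' same')
  rest≡rest' : removeAt u v ≡ removeAt u' v'
  rest≡rest' = arrange-injective w _ _
    (SameContent-removeLast c w u same) (SameContent-removeLast c w u' same') σ≡σ'

-- Every value x > v is σ₁₊ⱼ for some j, and bi-avoidance forbids wⱼ = c.
insertAt-isLastOccurrence : ∀ (v : Fin (suc n)) (c : Fin k) {σ w u} → IsPerm σ → ValueColouring σ w u →
                            BiAvoids12-00 (prepend v σ) (c ∷ w) → IsLastOccurrence c (insertAt u v c) v
insertAt-isLastOccurrence v c {σ} {w} {u} perm colours avoids = Vec.insertAt-lookup u v c , later≢c
  where
  later≢c : ∀ x → v Fin.< x → lookup (insertAt u v c) x ≢ c
  later≢c x v<x ux≡c = avoids zero (suc j) (s≤s z≤n) (subst (v Fin.<_) (sym σ[1+j]≡x) v<x) (sym wj≡c)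
    where
    open ≡-Reasoning
    u′ = insertAt u v c
    v≢x : v ≢ x
    v≢x eq = Fin.<-irrefl eq v<x
    j = proj₁ (isPerm⇒surjective σ perm (punchOut v≢x))
    σj≡y = proj₂ (isPerm⇒surjective σ perm (punchOut v≢x))
    σ[1+j]≡x : lookup (prepend v σ) (suc j) ≡ x
    σ[1+j]≡x = trans (lookup-prepend v σ j) (trans (cong (punchIn v) σj≡y) (Fin.punchIn-punchOut v≢x))
    wj≡c : lookup w j ≡ c
    wj≡c = begin
      lookup w j                                           ≡⟨ colours j ⟨
      lookup u (lookup σ j)                                ≡⟨ cong (lookup u) σj≡y ⟩
      lookup u (punchOut v≢x)                              ≡⟨ Vec.insertAt-punchIn u v c _ ⟨
      lookup (insertAt u v c) (punchIn v (punchOut v≢x))   ≡⟨ cong (lookup u′) (Fin.punchIn-punchOut v≢x) ⟩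
      lookup (insertAt u v c) x                            ≡⟨ ux≡c ⟩
      c                                                    ∎

arrange-surjective : ∀ (w : Vec (Fin k) n) σ → IsPerm σ → BiAvoids12-00 σ w →
                     ∃ λ u → SameContent w u × arrange w u ≡ σ
arrange-surjective []      []      _    _      = [] , (λ _ → refl) , refl
arrange-surjective (c ∷ w) (v ∷ τ) perm avoids with isPerm-prepend⁻ v τ perm
... | σ , σ-isPerm , refl with arrange-surjective w σ σ-isPerm (BiAvoids-prepend⁻ v σ c w avoids)
...   | u , same , refl = insertAt u v c , same′ , (begin
  prepend v′ (arrange w (removeAt (insertAt u v c) v′))
    ≡⟨ cong (λ i → prepend i (arrange w (removeAt (insertAt u v c) i))) v′≡v ⟩
  prepend v (arrange w (removeAt (insertAt u v c) v))
    ≡⟨ cong (prepend v ∘ arrange w) (Vec.removeAt-insertAt u v c) ⟩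
  prepend v (arrange w u) ∎)
  where
  open ≡-Reasoning
  same′ : SameContent (c ∷ w) (insertAt u v c)
  same′ = SameContent-insertAt c w u v same
  v′ = lastIndexOf c (insertAt u v c)
  v′≡v : v′ ≡ v
  v′≡v = IsLastOccurrence-unique c (insertAt u v c)
    (SameContent⇒isLastOccurrence c w (insertAt u v c) same′)
    (insertAt-isLastOccurrence v c σ-isPerm (arrange-colours w u same) avoids)

-- Words with prescribed content

content : Vec (Fin k) n → Vec ℕ k
content w = tabulate (λ c → occ c w)

lookup-content : ∀ (w : Vec (Fin k) n) c → lookup (content w) c ≡ occ c w
lookup-content w c = Vec.lookup∘tabulate _ c

content-∷ : ∀ (x : Fin k) (w : Vec (Fin k) n) → content (x ∷ w) ≡ updateAt (content w) x suc
content-∷ x w = lookup-ext λ c → trans (lookup-content (x ∷ w) c) (entry c)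
  where
  entry : ∀ c → occ c (x ∷ w) ≡ lookup (updateAt (content w) x suc) c
  entry c with c ≟ x
  ... | yes refl = trans (cong suc (sym (lookup-content w c))) (sym (Vec.lookup∘updateAt c (content w)))
  ... | no  c≢x  = trans (sym (lookup-content w c)) (sym (Vec.lookup∘updateAt′ c x c≢x (content w)))

SameContent⇒content≡ : (w u : Vec (Fin k) n) → SameContent w u → content w ≡ content u
SameContent⇒content≡ w u = Vec.tabulate-cong

content≡⇒SameContent : (w u : Vec (Fin k) n) → content w ≡ content u → SameContent w u
content≡⇒SameContent w u eq c =
  trans (sym (lookup-content w c)) (trans (cong (λ a → lookup a c) eq) (lookup-content u c))

sumVec-updateAt-suc : ∀ (a : Vec ℕ k) x → sumVec (updateAt a x suc) ≡ suc (sumVec a)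
sumVec-updateAt-suc (y ∷ a) zero    = refl
sumVec-updateAt-suc (y ∷ a) (suc x) =
  trans (cong (y +_) (sumVec-updateAt-suc a x)) (ℕ.+-suc y (sumVec a))

prodFact-updateAt-suc : ∀ (a : Vec ℕ k) x → prodFact (updateAt a x suc) ≡ suc (lookup a x) * prodFact a
prodFact-updateAt-suc (y ∷ a) zero    = ℕ.*-assoc (suc y) (y !) (prodFact a)
prodFact-updateAt-suc (y ∷ a) (suc x) = trans (cong (y ! *_) (prodFact-updateAt-suc a x))
                                              (ℕ*.x∙yz≈y∙xz (y !) (suc (lookup a x)) (prodFact a))

updateAt-suc-injective : ∀ (a b : Vec ℕ k) x → updateAt a x suc ≡ updateAt b x suc → a ≡ b
updateAt-suc-injective a b x eq = begin
  a                                      ≡⟨ undo a ⟨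
  updateAt (updateAt a x suc) x ℕ.pred   ≡⟨ cong (λ c → updateAt c x ℕ.pred) eq ⟩
  updateAt (updateAt b x suc) x ℕ.pred   ≡⟨ undo b ⟩
  b                                      ∎
  where
  open ≡-Reasoning
  undo : ∀ c → updateAt (updateAt c x suc) x ℕ.pred ≡ c
  undo c = trans (Vec.updateAt-updateAt x c) (Vec.updateAt-id x c)

updateAt-suc-view : ∀ (a : Vec ℕ k) x → lookup a x ≡ 0 ⊎ ∃ λ b → updateAt b x suc ≡ a
updateAt-suc-view a x with lookup a x in eq
... | zero  = inj₁ refl
... | suc m = inj₂ (updateAt a x ℕ.pred , trans
  (Vec.updateAt-updateAt-local x {h = id} a (trans (cong (λ m → suc (ℕ.pred m)) eq) (sym eq)))
  (Vec.updateAt-id x a))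

sumVec≡0⇒content[] : ∀ (a : Vec ℕ k) → sumVec a ≡ 0 → a ≡ content []
sumVec≡0⇒content[] []      _    = refl
sumVec≡0⇒content[] (x ∷ a) Σ≡0 with ℕ.m+n≡0⇒m≡0 x Σ≡0
... | refl = cong (0 ∷_) (sumVec≡0⇒content[] a Σ≡0)

sumVec-content-[] : ∀ k → sumVec (content {k} {0} []) ≡ 0
sumVec-content-[] zero    = refl
sumVec-content-[] (suc k) = sumVec-content-[] k

prodFact-content-[] : ∀ k → prodFact (content {k} {0} []) ≡ 1
prodFact-content-[] zero    = refl
prodFact-content-[] (suc k) = trans (ℕ.+-identityʳ _) (prodFact-content-[] k)

sumVec-content : ∀ (w : Vec (Fin k) n) → sumVec (content w) ≡ n
sumVec-content {k} []               = sumVec-content-[] k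
sumVec-content {n = suc n} (x ∷ w) = begin
  sumVec (content (x ∷ w))              ≡⟨ cong sumVec (content-∷ x w) ⟩
  sumVec (updateAt (content w) x suc)   ≡⟨ sumVec-updateAt-suc (content w) x ⟩
  suc (sumVec (content w))              ≡⟨ cong suc (sumVec-content w) ⟩
  suc n                                 ∎
  where open ≡-Reasoning

sum-lookup : ∀ (a : Vec ℕ k) → sum (List.map (lookup a) (allFin k)) ≡ sumVec a
sum-lookup []      = refl
sum-lookup (y ∷ a) = cong (y +_) (trans
  (cong sum (trans (List.map-tabulate suc (lookup (y ∷ a))) (sym (List.map-tabulate id (lookup a)))))
  (sum-lookup a))

_≟ᶜ_ : (a b : Vec ℕ k) → Dec (a ≡ b)
_≟ᶜ_ = Vec.≡-dec ℕ._≟_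

wordsWithContent : (n : ℕ) → Vec ℕ k → List (Vec (Fin k) n)
wordsWithContent {k} n a = filter (λ w → content w ≟ᶜ a) (allVecsOver (allFin k) n)

tailsWithContent : (n : ℕ) → Fin k → Vec ℕ k → List (Vec (Fin k) n)
tailsWithContent {k} n x a = filter (λ w → content (x ∷ w) ≟ᶜ a) (allVecsOver (allFin k) n)

length-wordsWithContent-suc : ∀ n (a : Vec ℕ k) →
  length (wordsWithContent (suc n) a) ≡ sum (List.map (λ x → length (tailsWithContent n x a)) (allFin k))
length-wordsWithContent-suc {k} n a = begin
  length (filter P? (concatMap (λ x → List.map (x ∷_) words) (allFin k)))
    ≡⟨ cong length (filter-concatMap P? _ (allFin k)) ⟩
  length (concatMap (λ x → filter P? (List.map (x ∷_) words)) (allFin k))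
    ≡⟨ cong length (List.concatMap-cong (λ x → filter-map P? (x ∷_) words) (allFin k)) ⟩
  length (concatMap (λ x → List.map (x ∷_) (tailsWithContent n x a)) (allFin k))
    ≡⟨ length-concatMap _ (allFin k) ⟩
  sum (List.map (λ x → length (List.map (x ∷_) (tailsWithContent n x a))) (allFin k))
    ≡⟨ cong sum (List.map-cong (λ x → List.length-map (x ∷_) (tailsWithContent n x a)) (allFin k)) ⟩
  sum (List.map (λ x → length (tailsWithContent n x a)) (allFin k)) ∎
  where
  open ≡-Reasoning
  words = allVecsOver (allFin k) n
  P? = λ (w : Vec (Fin k) (suc n)) → content w ≟ᶜ a

tailsWithContent-absent : ∀ n {a : Vec ℕ k} {x} → lookup a x ≡ 0 → tailsWithContent n x a ≡ []
tailsWithContent-absent {k} n {a} {x} ax≡0 = List.filter-none (λ w → content (x ∷ w) ≟ᶜ a)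
  {xs = allVecsOver (allFin k) n} (All.universal (λ w eq → ℕ.1+n≢0 (begin
    suc (lookup (content w) x)              ≡⟨ Vec.lookup∘updateAt x (content w) ⟨
    lookup (updateAt (content w) x suc) x   ≡⟨ cong (λ b → lookup b x) (content-∷ x w) ⟨
    lookup (content (x ∷ w)) x              ≡⟨ cong (λ b → lookup b x) eq ⟩
    lookup a x                              ≡⟨ ax≡0 ⟩
    0                                       ∎)) _)
  where open ≡-Reasoning

tailsWithContent-updateAt : ∀ n (b : Vec ℕ k) x →
                            tailsWithContent n x (updateAt b x suc) ≡ wordsWithContent n b
tailsWithContent-updateAt {k} n b x = List.filter-≐ _ _
  ( (λ {w} eq → updateAt-suc-injective (content w) b x (trans (sym (content-∷ x w)) eq))
  , (λ {w} eq → trans (content-∷ x w) (cong (λ c → updateAt c x suc) eq)))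
  (allVecsOver (allFin k) n)

tailsWithContent-count :
  (∀ (b : Vec ℕ k) → sumVec b ≡ n → length (wordsWithContent n b) * prodFact b ≡ n !) →
  ∀ (a : Vec ℕ k) x → sumVec a ≡ suc n → length (tailsWithContent n x a) * prodFact a ≡ lookup a x * n !
tailsWithContent-count {n = n} words-count a x Σa≡1+n with updateAt-suc-view a x
... | inj₁ ax≡0 = begin
  length (tailsWithContent n x a) * prodFact a
    ≡⟨ cong (λ ws → length ws * prodFact a) (tailsWithContent-absent n ax≡0) ⟩
  0
    ≡⟨ cong (_* n !) ax≡0 ⟨
  lookup a x * n ! ∎
  where open ≡-Reasoning
... | inj₂ (b , refl) = begin
  length (tailsWithContent n x (updateAt b x suc)) * prodFact (updateAt b x suc)
    ≡⟨ cong₂ (λ ws p → length ws * p) (tailsWithContent-updateAt n b x) (prodFact-updateAt-suc b x) ⟩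
  length (wordsWithContent n b) * (suc (lookup b x) * prodFact b)
    ≡⟨ ℕ*.x∙yz≈y∙xz (length (wordsWithContent n b)) (suc (lookup b x)) (prodFact b) ⟩
  suc (lookup b x) * (length (wordsWithContent n b) * prodFact b)
    ≡⟨ cong (suc (lookup b x) *_) (words-count b Σb≡n) ⟩
  suc (lookup b x) * n !
    ≡⟨ cong (_* n !) (Vec.lookup∘updateAt x b) ⟨
  lookup (updateAt b x suc) x * n ! ∎
  where
  open ≡-Reasoning
  Σb≡n : sumVec b ≡ n
  Σb≡n = ℕ.suc-injective (trans (sym (sumVec-updateAt-suc b x)) Σa≡1+n)

wordsWithContent-count : ∀ n (a : Vec ℕ k) → sumVec a ≡ n →
                         length (wordsWithContent n a) * prodFact a ≡ n !
wordsWithContent-count {k} zero a Σa≡0 with sumVec≡0⇒content[] a Σa≡0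
... | refl rewrite List.filter-accept (λ w → content w ≟ᶜ content {k} {0} []) {x = []} {xs = []} refl
                 | prodFact-content-[] k = refl
wordsWithContent-count {k} (suc n) a Σa≡1+n = begin
  length (wordsWithContent (suc n) a) * prodFact a
    ≡⟨ cong (_* prodFact a) (length-wordsWithContent-suc n a) ⟩
  sum (List.map (λ x → length (tailsWithContent n x a)) (allFin k)) * prodFact a
    ≡⟨ sum-map-*ʳ _ (prodFact a) (allFin k) ⟩
  sum (List.map (λ x → length (tailsWithContent n x a) * prodFact a) (allFin k))
    ≡⟨ cong sum (List.map-cong tails-count (allFin k)) ⟩
  sum (List.map (λ x → lookup a x * n !) (allFin k))
    ≡⟨ sum-map-*ʳ (lookup a) (n !) (allFin k) ⟨
  sum (List.map (lookup a) (allFin k)) * n !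
    ≡⟨ cong (_* n !) (trans (sum-lookup a) Σa≡1+n) ⟩
  suc n * n ! ∎
  where
  open ≡-Reasoning
  tails-count : ∀ x → length (tailsWithContent n x a) * prodFact a ≡ lookup a x * n !
  tails-count x = tailsWithContent-count (wordsWithContent-count n) a x Σa≡1+n

multinomial≡length-wordsWithContent : ∀ n (a : Vec ℕ k) → sumVec a ≡ n →
                                      multinomial n a ≡ length (wordsWithContent n a)
multinomial≡length-wordsWithContent n a Σa≡n = begin
  ((n !) / prodFact a) {{prodFact-nonZero a}}
    ≡⟨ cong (λ m → (m / prodFact a) {{prodFact-nonZero a}}) (wordsWithContent-count n a Σa≡n) ⟨
  ((length (wordsWithContent n a) * prodFact a) / prodFact a) {{prodFact-nonZero a}}
    ≡⟨ m*n/n≡m (length (wordsWithContent n a)) (prodFact a) {{prodFact-nonZero a}} ⟩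
  length (wordsWithContent n a) ∎
  where open ≡-Reasoning

-- Pairs of words with equal content

∈-wordsWithContent⁺ : ∀ {a : Vec ℕ k} (w : Vec (Fin k) n) → content w ≡ a → w ∈ wordsWithContent n a
∈-wordsWithContent⁺ {k} {a = a} w eq = ∈-filter⁺ (λ w → content w ≟ᶜ a)
  (allVecsOver-complete _ w (λ i → ∈-allFin (lookup w i))) eq

∈-wordsWithContent⁻ : ∀ {a : Vec ℕ k} {w : Vec (Fin k) n} → w ∈ wordsWithContent n a → content w ≡ a
∈-wordsWithContent⁻ {k} {n} {a} w∈ =
  proj₂ (∈-filter⁻ (λ w → content w ≟ᶜ a) {xs = allVecsOver (allFin k) n} w∈)

wordsWithContent-unique : ∀ n (a : Vec ℕ k) → Unique (wordsWithContent n a)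
wordsWithContent-unique {k} n a = Unique.filter⁺ _ (allVecsOver-unique n (Unique.allFin⁺ k))

content∈compositions : ∀ (w : Vec (Fin k) n) → content w ∈ compositions n k
content∈compositions {k} {n} w = ∈-filter⁺ (λ v → sumVec v ℕ.≟ n)
  (allVecsOver-complete k (content w) λ c →
    ∈-upTo⁺ (subst (ℕ._< suc n) (sym (lookup-content w c)) (s≤s (Vec.count≤n _ w))))
  (sumVec-content w)

∈-compositions⁻ : ∀ {a : Vec ℕ k} → a ∈ compositions n k → sumVec a ≡ n
∈-compositions⁻ {k} {n} a∈ =
  proj₂ (∈-filter⁻ (λ v → sumVec v ℕ.≟ n) {xs = allVecsOver (upTo (suc n)) k} a∈)

sameContentPairs : (n k : ℕ) → List (Vec (Fin k) n × Vec (Fin k) n)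
sameContentPairs n k =
  concatMap (λ a → cartesianProduct (wordsWithContent n a) (wordsWithContent n a)) (compositions n k)

sameContentPairs-hasCard : ∀ n k → HasCard (uncurry (SameContent {k} {n})) (multinomialSqSum n k)
sameContentPairs-hasCard n k = sameContentPairs n k , unique , (λ p → ∈⇒same p , same⇒∈ p) , length≡
  where
  square : Vec ℕ k → List (Vec (Fin k) n × Vec (Fin k) n)
  square a = cartesianProduct (wordsWithContent n a) (wordsWithContent n a)

  unique : Unique (sameContentPairs n k)
  unique = Unique-concatMap square
    (Unique.filter⁺ _ (allVecsOver-unique k (Unique.upTo⁺ (suc n))))
    (λ a → Unique.cartesianProduct⁺ (wordsWithContent-unique n a) (wordsWithContent-unique n a))
    (λ {a} {b} p∈a p∈b → trans (sym (∈-wordsWithContent⁻ (proj₁ (∈-cartesianProduct⁻ _ _ p∈a))))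
                               (∈-wordsWithContent⁻ (proj₁ (∈-cartesianProduct⁻ _ _ p∈b))))

  ∈⇒same : ∀ p → p ∈ sameContentPairs n k → uncurry SameContent p
  ∈⇒same (w , u) p∈ with Any.satisfied (∈-concatMap⁻ square {xs = compositions n k} p∈)
  ... | a , p∈a with ∈-cartesianProduct⁻ _ _ p∈a
  ...   | w∈ , u∈ =
    content≡⇒SameContent w u (trans (∈-wordsWithContent⁻ w∈) (sym (∈-wordsWithContent⁻ u∈)))

  same⇒∈ : ∀ p → uncurry SameContent p → p ∈ sameContentPairs n k
  same⇒∈ (w , u) same = ∈-concatMap⁺ square (Any.map (λ { refl →
    ∈-cartesianProduct⁺ (∈-wordsWithContent⁺ w refl)
                        (∈-wordsWithContent⁺ u (sym (SameContent⇒content≡ w u same))) })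
    (content∈compositions w))

  length≡ : length (sameContentPairs n k) ≡ multinomialSqSum n k
  length≡ = trans (length-concatMap square (compositions n k))
    (cong sum (List.map-cong-local (All.tabulate λ {a} a∈ →
      let |W|≡multinomial = sym (multinomial≡length-wordsWithContent n a (∈-compositions⁻ {k} {n} a∈)) in
      trans (length-cartesianProduct (wordsWithContent n a) (wordsWithContent n a))
            (cong₂ _*_ |W|≡multinomial |W|≡multinomial))))

arrangePair : Vec (Fin k) n × Vec (Fin k) n → Vec (Fin n) n × Vec (Fin k) n
arrangePair (w , u) = arrange w u , w

arrangePair-good : ∀ (p : Vec (Fin k) n × Vec (Fin k) n) →
                   uncurry SameContent p → Good k n (arrangePair p)
arrangePair-good (w , u) same = arrange-isPerm w u , arrange-biAvoids w u same

arrangePair-injective : ∀ (p p' : Vec (Fin k) n × Vec (Fin k) n) →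
                        uncurry SameContent p → uncurry SameContent p' →
                        arrangePair p ≡ arrangePair p' → p ≡ p'
arrangePair-injective (w , u) (w' , u') same same' eq with cong proj₂ eq
... | refl = cong (w ,_) (arrange-injective w u u' same same' (cong proj₁ eq))

arrangePair-onto : ∀ (q : Vec (Fin n) n × Vec (Fin k) n) →
                   Good k n q → ∃ λ p → uncurry SameContent p × arrangePair p ≡ q
arrangePair-onto (σ , w) (perm , avoids) with arrange-surjective w σ perm avoids
... | u , same , refl = (w , u) , same , refl

theorem1 : (k n : ℕ) → 1 ≤ k → HasCard (Good k n) (multinomialSqSum n k)
theorem1 k n _ = HasCard-bijection arrangePair arrangePair-good arrangePair-injective arrangePair-onto
  (sameContentPairs-hasCard n k)
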